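{- Let $\mathcal{T}$ be the semiregular planar tiling $(p.4.q.4)$ with $p\neq q$. Then the number of perfect precise $4$-colorings of $\mathcal{T}$ is (1) one if and only if $p$ and $q$ are even and neither is a multiple of $3$, or one of $p$ and $q$ is even and the other is an odd multiple of $3$; (2) two if and only if $p$ and $q$ are even and exactly one of them is a multiple of $3$; (3) three if and only if $p$ and $q$ are multiples of $6$.
   Context: A semiregular tiling $(p_1.p_2.\cdots.p_k)$ of the plane (spherical, Euclidean or hyperbolic) is an edge-to-edge tiling by regular polygons in which around every vertex there occur a $p_1$-gon, ..., a $p_k$-gon in this cyclic order or in reverse; it is $k$-valent. An $n$-coloring is a surjective map from the set of tiles to a set of $n$ colors. For a $k$-valent tiling, a $k$-coloring is precise if all $k$ colors appear at every vertex. A coloring is perfect if every element of the symmetry group $G$ of the uncolored tiling permutes the colors (maps each color class onto a color class). Colorings are counted as partitions of the tiles into color classes, up to the action of the symmetry group of the tiling. -}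

module Defs where

-- Combinatorial (Wythoff) model of the semiregular tiling (p.4.q.4) = rr{p,q}.
-- Its symmetry group (for p ≠ q) is the Coxeter group [p,q] with generators
-- r0 r1 r2 and relations r_i^2 = (r0 r1)^p = (r1 r2)^q = (r0 r2)^2 = 1.
-- Tiles:  p-gons = cosets g⟨r0,r1⟩,  q-gons = cosets g⟨r1,r2⟩,
--         squares = cosets g⟨r0,r2⟩.
-- Vertices: cosets g⟨r1⟩; the vertex g⟨r1⟩ is surrounded (in cyclic order)
-- by the p-gon g⟨r0,r1⟩, the square g⟨r0,r2⟩, the q-gon g⟨r1,r2⟩ and the
-- square g r1⟨r0,r2⟩.

open import Data.Nat using (ℕ; zero; suc)
open import Data.Fin using (Fin)
open import Data.List using (List; []; _∷_; _++_; [_])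
open import Data.List.Relation.Unary.All using (All)
open import Data.Product using (Σ; _×_)
open import Relation.Binary.PropositionalEquality using (_≡_; _≢_)
open import Function.Bundles using (_↔_; Inverse)

data Gen : Set where
  r0 r1 r2 : Gen

Word : Set
Word = List Gen

pow : ℕ → Word → Word
pow zero    w = []
pow (suc n) w = w ++ pow n w

data Relator (p q : ℕ) : Word → Set where
  sq0  : Relator p q (r0 ∷ r0 ∷ [])
  sq1  : Relator p q (r1 ∷ r1 ∷ [])
  sq2  : Relator p q (r2 ∷ r2 ∷ [])
  rel01 : Relator p q (pow p (r0 ∷ r1 ∷ []))
  rel12 : Relator p q (pow q (r1 ∷ r2 ∷ []))
  rel02 : Relator p q (pow 2 (r0 ∷ r2 ∷ []))

data _≈[_,_]_ : Word → ℕ → ℕ → Word → Set where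
  ≈-refl  : ∀ {p q u} → u ≈[ p , q ] u
  ≈-sym   : ∀ {p q u v} → u ≈[ p , q ] v → v ≈[ p , q ] u
  ≈-trans : ∀ {p q u v w} → u ≈[ p , q ] v → v ≈[ p , q ] w → u ≈[ p , q ] w
  ≈-rel   : ∀ {p q} u r v → Relator p q r → (u ++ r ++ v) ≈[ p , q ] (u ++ v)

-- tile kinds: P = p-gons, Q = q-gons, S = squares
data Kind : Set where
  P Q S : Kind

-- generators of the stabiliser subgroup of the base tile of each kind
InStab : Kind → Gen → Set
InStab P x = x ≢ r2
InStab Q x = x ≢ r0
InStab S x = x ≢ r1

SameTile : ℕ → ℕ → Kind → Word → Word → Set
SameTile p q k g g' = Σ Word λ h → All (InStab k) h × ((g ++ h) ≈[ p , q ] g')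

-- a 4-coloring, given on representatives (k , g) of tiles
Coloring : Set
Coloring = Kind → Word → Fin 4

WellDefined : ℕ → ℕ → Coloring → Set
WellDefined p q c = ∀ k g g' → SameTile p q k g g' → c k g ≡ c k g'

Distinct4 : Fin 4 → Fin 4 → Fin 4 → Fin 4 → Set
Distinct4 a b c d =
  a ≢ b × a ≢ c × a ≢ d × b ≢ c × b ≢ d × c ≢ d

Precise : Coloring → Set
Precise c = ∀ g → Distinct4 (c P g) (c S g) (c Q g) (c S (g ++ [ r1 ]))

Perfect : Coloring → Set
Perfect c = ∀ g → Σ (Fin 4 ↔ Fin 4) λ σ →
  ∀ k h → c k (g ++ h) ≡ Inverse.to σ (c k h)

PerfectPrecise : ℕ → ℕ → Coloring → Set
PerfectPrecise p q c = WellDefined p q c × Precise c × Perfect c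

-- same partition into color classes, up to a symmetry of the tiling
Equivalent : Coloring → Coloring → Set
Equivalent c c' = Σ Word λ g → Σ (Fin 4 ↔ Fin 4) λ σ →
  ∀ k h → c' k h ≡ Inverse.to σ (c k (g ++ h))

NumPerfectPrecise : ℕ → ℕ → ℕ → Set
NumPerfectPrecise p q n = Σ (Fin n → Coloring) λ cs →
  (∀ i → PerfectPrecise p q (cs i)) ×
  (∀ i j → Equivalent (cs i) (cs j) → i ≡ j) ×
  (∀ c → PerfectPrecise p q c → Σ (Fin n) λ i → Equivalent (cs i) c)

{-# OPTIONS --safe #-}
module Submission where

-- After renaming colours, the p-gon, square, q-gon and second square at the base vertex
-- carry colours 0, 1, 2, 3. A perfect colouring is then determined by the colour
-- permutations σ₀, σ₁, σ₂ induced by the reflections r0, r1, r2. As r1 fixes the p-gon and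
-- the q-gon and swaps the squares, σ₁ = (1 3); r0 fixes the p-gon and the square, so σ₀ ∈
-- {1, (2 3)}; r2 fixes the square and the q-gon, so σ₂ ∈ {1, (0 3)}; and (r0 r2)² = 1
-- excludes σ₀ and σ₂ both being transpositions. Of the three remaining "twists", each
-- defines a colouring exactly when the rotations r0 r1 and r1 r2, which act on colour 1 as
-- cycles of length 2 or 3, have orders dividing p and q. Distinct twists give inequivalent
-- colourings, since an equivalence preserves whether r0 fixes the colour of the base q-gon
-- and whether r2 fixes that of the base p-gon. So the number of classes is the number of
-- twists among (2 ∣ p, 2 ∣ q), (3 ∣ p, 2 ∣ q), (2 ∣ p, 3 ∣ q) whose divisibility
-- conditions hold.

open import Defs
open import Data.Bool using (true; false; if_then_else_)
open import Data.Fin using (Fin; zero; suc; _≟_)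
open import Data.Fin.Patterns using (0F; 1F; 2F; 3F)
open import Data.Fin.Permutation
  using (Permutation′; _⟨$⟩ʳ_; _⟨$⟩ˡ_; inverseˡ; inverseʳ; flip; transpose; _∘ₚ_; _≈_)
  renaming (id to idₚ)
open import Data.Fin.Properties using (any?; injective⇒≤; cantor-schröder-bernstein)
open import Data.List using (List; []; _∷_; _++_; [_]; length; lookup; filter)
open import Data.List.Properties using (++-assoc; ++-identityʳ)
open import Data.List.Membership.Propositional using (_∈_)
open import Data.List.Membership.Propositional.Properties using (∈-filter⁺; ∈-filter⁻; ∈-lookup)
open import Data.List.Relation.Unary.All using (All; []; _∷_)
import Data.List.Relation.Unary.All as All
open import Data.List.Relation.Unary.AllPairs using ([]; _∷_)
open import Data.List.Relation.Unary.Any using (here; there; index)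
open import Data.List.Relation.Unary.Any.Properties using (lookup-index)
open import Data.List.Relation.Unary.Unique.Propositional using (Unique)
import Data.List.Relation.Unary.Unique.Propositional.Properties as Unique
open import Data.Nat using (ℕ; zero; suc; _+_; _*_; _<_; _≤_; s≤s; NonZero)
  renaming (_≟_ to _≟ℕ_)
open import Data.Nat.DivMod using (_%_; _/_; m≡m%n+[m/n]*n; m%n<n)
open import Data.Nat.Divisibility using (_∣_; _∣?_; divides; ∣-trans; m%n≡0⇒n∣m)
open import Data.Nat.GeneralisedArithmetic using (fold; fold-+)
open import Data.Nat.LCM using (lcm-least)
open import Data.Nat.Properties using (n≢0⇒n>0; 1+n≰n)
open import Data.Product using (Σ; _×_; _,_; proj₁; proj₂)
open import Data.Product.Function.NonDependent.Propositional using (_×-⇔_)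
open import Data.Sum using (_⊎_; inj₁; inj₂)
import Data.Vec as Vec
open import Function using (_∘_)
open import Function.Bundles using (_⇔_; mk⇔; mk⤖; Injection; Equivalence)
open import Function.Consequences.Propositional using (strictlySurjective⇒surjective)
open import Function.Definitions using (Injective; StrictlySurjective)
open import Function.Properties.Bijection using (⤖⇒↔)
open import Function.Properties.Equivalence using () renaming (trans to ⇔-trans; sym to ⇔-sym)
open import Function.Properties.Inverse using (↔⇒↣)
open import Relation.Nullary using (¬_; Dec; yes; no; does; contradiction)
open import Relation.Nullary.Decidable using (decidable-stable; _×-dec_; _⊎-dec_; ¬?)
open import Relation.Unary using (Decidable)
open import Relation.Binary.PropositionalEquality
  using (_≡_; _≢_; refl; sym; trans; cong; subst; module ≡-Reasoning)
open ≡-Reasoning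

private
  variable
    n p q : ℕ

⟨$⟩ʳ-injective : (π : Permutation′ n) → Injective _≡_ _≡_ (π ⟨$⟩ʳ_)
⟨$⟩ʳ-injective π = Injection.injective (↔⇒↣ π)

module _ {f : Fin n → Fin n} (f-injective : Injective _≡_ _≡_ f) where

  injective⇒strictlySurjective : StrictlySurjective _≡_ f
  injective⇒strictlySurjective y with any? (λ i → f i ≟ y)
  ... | yes preimage = preimage
  ... | no y∉image = contradiction (injective⇒≤ extension-injective) (1+n≰n)
    where
    extension : Fin (suc n) → Fin n
    extension zero    = y
    extension (suc i) = f i

    extension-injective : Injective _≡_ _≡_ extension
    extension-injective {zero}  {zero}  _     = refl
    extension-injective {zero}  {suc j} y≡fj  = contradiction (j , sym y≡fj) y∉image
    extension-injective {suc i} {zero}  fi≡y  = contradiction (i , fi≡y) y∉image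
    extension-injective {suc i} {suc j} fi≡fj = cong suc (f-injective fi≡fj)

  injective⇒permutation : Permutation′ n
  injective⇒permutation =
    ⤖⇒↔ (mk⤖ (f-injective , strictlySurjective⇒surjective injective⇒strictlySurjective))

≈-fromAllBut : (σ τ : Permutation′ n) (j : Fin n) →
               (∀ i → i ≢ j → σ ⟨$⟩ʳ i ≡ τ ⟨$⟩ʳ i) → σ ≈ τ
≈-fromAllBut σ τ j agree i with i ≟ j
... | no i≢j = agree i i≢j
... | yes refl with σ ⟨$⟩ˡ (τ ⟨$⟩ʳ i) ≟ i
...   | yes k≡i = trans (cong (σ ⟨$⟩ʳ_) (sym k≡i)) (inverseʳ σ)
...   | no k≢i  = contradiction (⟨$⟩ʳ-injective τ (trans (sym (agree _ k≢i)) (inverseʳ σ))) k≢i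

distinct4⇒injective : ∀ {a b c d} → Distinct4 a b c d →
                      Injective _≡_ _≡_ (Vec.lookup (a Vec.∷ b Vec.∷ c Vec.∷ d Vec.∷ Vec.[]))
distinct4⇒injective {a} {b} {c} {d} (a≢b , a≢c , a≢d , b≢c , b≢d , c≢d) = injective
  where
  injective : Injective _≡_ _≡_ (Vec.lookup (a Vec.∷ b Vec.∷ c Vec.∷ d Vec.∷ Vec.[]))
  injective {0F} {0F} _ = refl
  injective {0F} {1F} e = contradiction e a≢b
  injective {0F} {2F} e = contradiction e a≢c
  injective {0F} {3F} e = contradiction e a≢d
  injective {1F} {0F} e = contradiction (sym e) a≢b
  injective {1F} {1F} _ = refl
  injective {1F} {2F} e = contradiction e b≢c
  injective {1F} {3F} e = contradiction e b≢d
  injective {2F} {0F} e = contradiction (sym e) a≢c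
  injective {2F} {1F} e = contradiction (sym e) b≢c
  injective {2F} {2F} _ = refl
  injective {2F} {3F} e = contradiction e c≢d
  injective {3F} {0F} e = contradiction (sym e) a≢d
  injective {3F} {1F} e = contradiction (sym e) b≢d
  injective {3F} {2F} e = contradiction (sym e) c≢d
  injective {3F} {3F} _ = refl

distinct4⇒permutation : ∀ {a b c d} → Distinct4 a b c d → Permutation′ 4
distinct4⇒permutation distinct = injective⇒permutation (distinct4⇒injective distinct)

distinct4-exhaustive : ∀ {a b c d x} → Distinct4 a b c d →
                       x ≢ a → x ≢ b → x ≢ c → x ≡ d
distinct4-exhaustive {x = x} distinct x≢a x≢b x≢c with π ⟨$⟩ˡ x | inverseʳ π {x}
  where
  π : Permutation′ 4
  π = distinct4⇒permutation distinct
... | 0F | a≡x = contradiction (sym a≡x) x≢a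
... | 1F | b≡x = contradiction (sym b≡x) x≢b
... | 2F | c≡x = contradiction (sym c≡x) x≢c
... | 3F | d≡x = sym d≡x

map-distinct4 : ∀ {a b c d} {f : Fin 4 → Fin 4} → Injective _≡_ _≡_ f →
                Distinct4 a b c d → Distinct4 (f a) (f b) (f c) (f d)
map-distinct4 inj (a≢b , a≢c , a≢d , b≢c , b≢d , c≢d) =
  a≢b ∘ inj , a≢c ∘ inj , a≢d ∘ inj , b≢c ∘ inj , b≢d ∘ inj , c≢d ∘ inj

distinct-0123 : Distinct4 0F 1F 2F 3F
distinct-0123 = (λ ()) , (λ ()) , (λ ()) , (λ ()) , (λ ()) , (λ ())

module _ {A : Set} (f : A → A) {x : A} where

  fold-fixed-multiple : ∀ m → fold x f m ≡ x → ∀ k → fold x f (k * m) ≡ x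
  fold-fixed-multiple m fᵐx≡x zero    = refl
  fold-fixed-multiple m fᵐx≡x (suc k) = begin
    fold x f (m + k * m)          ≡⟨ fold-+ x f m ⟩
    fold (fold x f (k * m)) f m   ≡⟨ cong (λ y → fold y f m) (fold-fixed-multiple m fᵐx≡x k) ⟩
    fold x f m                    ≡⟨ fᵐx≡x ⟩
    x                             ∎

  fold-period : ∀ m {n} .{{_ : NonZero m}} → fold x f m ≡ x →
                (∀ {i} → 0 < i → i < m → fold x f i ≢ x) →
                fold x f n ≡ x → m ∣ n
  fold-period m {n} fᵐx≡x minimal fⁿx≡x = m%n≡0⇒n∣m n m
    (decidable-stable (n % m ≟ℕ 0) λ r≢0 → minimal (n≢0⇒n>0 r≢0) (m%n<n n m) fʳx≡x)
    where
    fʳx≡x : fold x f (n % m) ≡ x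
    fʳx≡x = begin
      fold x f (n % m)                          ≡⟨ cong (λ y → fold y f (n % m)) (fold-fixed-multiple m fᵐx≡x (n / m)) ⟨
      fold (fold x f (n / m * m)) f (n % m)     ≡⟨ fold-+ x f (n % m) ⟨
      fold x f (n % m + n / m * m)              ≡⟨ cong (fold x f) (m≡m%n+[m/n]*n n m) ⟨
      fold x f n                                ≡⟨ fⁿx≡x ⟩
      x                                         ∎

  period-2 : f x ≢ x → f (f x) ≡ x → fold x f n ≡ x → 2 ∣ n
  period-2 fx≢x ffx≡x = fold-period 2 ffx≡x λ
    { {1}           _ _                 → fx≢x
    ; {suc (suc _)} _ (s≤s (s≤s ()))
    }

  period-3 : f x ≢ x → f (f x) ≢ x → f (f (f x)) ≡ x → fold x f n ≡ x → 3 ∣ n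
  period-3 fx≢x ffx≢x fffx≡x = fold-period 3 fffx≡x λ
    { {1}                 _ _                       → fx≢x
    ; {2}                 _ _                       → ffx≢x
    ; {suc (suc (suc _))} _ (s≤s (s≤s (s≤s ())))
    }

module _ (γ : Gen → Permutation′ n) where

  act : Word → Permutation′ n
  act []      = idₚ
  act (x ∷ w) = act w ∘ₚ γ x

  act-++ : ∀ g h y → act (g ++ h) ⟨$⟩ʳ y ≡ act g ⟨$⟩ʳ (act h ⟨$⟩ʳ y)
  act-++ []      h y = refl
  act-++ (x ∷ g) h y = cong (γ x ⟨$⟩ʳ_) (act-++ g h y)

  act-pow : ∀ m w y → act (pow m w) ⟨$⟩ʳ y ≡ fold y (act w ⟨$⟩ʳ_) m
  act-pow zero    w y = refl
  act-pow (suc m) w y = trans (act-++ w (pow m w) y) (cong (act w ⟨$⟩ʳ_) (act-pow m w y))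

  act-resp-≈ : (∀ {r} → Relator p q r → ∀ y → act r ⟨$⟩ʳ y ≡ y) →
               ∀ {u v} → u ≈[ p , q ] v → ∀ y → act u ⟨$⟩ʳ y ≡ act v ⟨$⟩ʳ y
  act-resp-≈ trivial ≈-refl            y = refl
  act-resp-≈ trivial (≈-sym v≈u)       y = sym (act-resp-≈ trivial v≈u y)
  act-resp-≈ trivial (≈-trans u≈v v≈w) y = trans (act-resp-≈ trivial u≈v y) (act-resp-≈ trivial v≈w y)
  act-resp-≈ trivial (≈-rel u r v R)   y = begin
    act (u ++ r ++ v) ⟨$⟩ʳ y            ≡⟨ act-++ u (r ++ v) y ⟩
    act u ⟨$⟩ʳ (act (r ++ v) ⟨$⟩ʳ y)    ≡⟨ cong (act u ⟨$⟩ʳ_) (trans (act-++ r v y) (trivial R _)) ⟩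
    act u ⟨$⟩ʳ (act v ⟨$⟩ʳ y)           ≡⟨ act-++ u v y ⟨
    act (u ++ v) ⟨$⟩ʳ y                 ∎

inverse : Word → Word
inverse []      = []
inverse (x ∷ w) = inverse w ++ [ x ]

involution-relator : ∀ x → Relator p q (x ∷ x ∷ [])
involution-relator r0 = sq0
involution-relator r1 = sq1
involution-relator r2 = sq2

≡⇒≈ : ∀ {u v} → u ≡ v → u ≈[ p , q ] v
≡⇒≈ refl = ≈-refl

cancel-inverse : ∀ u g v → (u ++ g ++ inverse g ++ v) ≈[ p , q ] (u ++ v)
cancel-inverse u []      v = ≈-refl
cancel-inverse u (x ∷ g) v =
  ≈-trans (≡⇒≈ regroup)
    (≈-trans (cancel-inverse (u ++ [ x ]) g (x ∷ v))
      (≈-trans (≡⇒≈ (++-assoc u [ x ] (x ∷ v))) (≈-rel u (x ∷ x ∷ []) v (involution-relator x))))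
  where
  regroup : u ++ x ∷ g ++ (inverse g ++ [ x ]) ++ v ≡ (u ++ [ x ]) ++ g ++ inverse g ++ x ∷ v
  regroup = begin
    u ++ x ∷ g ++ (inverse g ++ [ x ]) ++ v   ≡⟨ cong (λ w → u ++ x ∷ g ++ w) (++-assoc (inverse g) [ x ] v) ⟩
    u ++ x ∷ g ++ inverse g ++ x ∷ v          ≡⟨ ++-assoc u [ x ] _ ⟨
    (u ++ [ x ]) ++ g ++ inverse g ++ x ∷ v   ∎

private
  variable
    c c′ c″ : Coloring

Equivalent-trans : Equivalent c c′ → Equivalent c′ c″ → Equivalent c c″
Equivalent-trans {c} {c′} {c″} (g , σ , c′≡) (g′ , τ , c″≡) = g ++ g′ , σ ∘ₚ τ , λ k h → begin
  c″ k h                                  ≡⟨ c″≡ k h ⟩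
  τ ⟨$⟩ʳ c′ k (g′ ++ h)                   ≡⟨ cong (τ ⟨$⟩ʳ_) (c′≡ k (g′ ++ h)) ⟩
  τ ⟨$⟩ʳ (σ ⟨$⟩ʳ c k (g ++ g′ ++ h))      ≡⟨ cong (λ w → τ ⟨$⟩ʳ (σ ⟨$⟩ʳ c k w)) (++-assoc g g′ h) ⟨
  τ ⟨$⟩ʳ (σ ⟨$⟩ʳ c k ((g ++ g′) ++ h))    ∎

Equivalent-sym : WellDefined p q c → Equivalent c c′ → Equivalent c′ c
Equivalent-sym {p} {q} {c} {c′} wd (g , σ , c′≡) = inverse g , flip σ , λ k h → begin
  c k h                                   ≡⟨ wd k (g ++ inverse g ++ h) h ([] , [] , cancelled) ⟨
  c k (g ++ inverse g ++ h)               ≡⟨ inverseˡ σ ⟨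
  σ ⟨$⟩ˡ (σ ⟨$⟩ʳ c k (g ++ inverse g ++ h)) ≡⟨ cong (σ ⟨$⟩ˡ_) (c′≡ k (inverse g ++ h)) ⟨
  σ ⟨$⟩ˡ c′ k (inverse g ++ h)            ∎
  where
  cancelled : ∀ {h} → ((g ++ inverse g ++ h) ++ []) ≈[ p , q ] h
  cancelled {h} = ≈-trans (≡⇒≈ (++-identityʳ _)) (cancel-inverse [] g h)

equivalent-coincidence : Perfect c → Equivalent c c′ →
                         ∀ k h h′ → (c k h ≡ c k h′ ⇔ c′ k h ≡ c′ k h′)
equivalent-coincidence {c} {c′} perfect (g , σ , c′≡) k h h′ with τ , c≡ ← perfect g =
  mk⇔ (λ e → trans (c′≡F h) (trans (cong F e) (sym (c′≡F h′))))
      (λ e → ⟨$⟩ʳ-injective (τ ∘ₚ σ) (trans (sym (c′≡F h)) (trans e (c′≡F h′))))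
  where
  F : Fin 4 → Fin 4
  F = (τ ∘ₚ σ) ⟨$⟩ʳ_

  c′≡F : ∀ h → c′ k h ≡ F (c k h)
  c′≡F h = trans (c′≡ k h) (cong (σ ⟨$⟩ʳ_) (c≡ k h))

recolour : Permutation′ 4 → Coloring → Coloring
recolour π c k h = π ⟨$⟩ʳ c k h

recolour-wellDefined : ∀ π → WellDefined p q c → WellDefined p q (recolour π c)
recolour-wellDefined π wd k g g′ same = cong (π ⟨$⟩ʳ_) (wd k g g′ same)

recolour-perfect : ∀ π → Perfect c → Perfect (recolour π c)
recolour-perfect {c} π perfect g with σ , c≡ ← perfect g =
  flip π ∘ₚ σ ∘ₚ π , λ k h → cong (π ⟨$⟩ʳ_) (trans (c≡ k h) (cong (σ ⟨$⟩ʳ_) (sym (inverseˡ π))))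

-- Twists and their model colourings

data Twist : Set where
  untwisted twisted₀ twisted₂ : Twist

private
  variable
    t t′ : Twist

generator : Twist → Gen → Permutation′ 4
generator _        r1 = transpose 1F 3F
generator twisted₀ r0 = transpose 2F 3F
generator twisted₂ r2 = transpose 0F 3F
generator _        _  = idₚ

baseColour : Kind → Fin 4
baseColour P = 0F
baseColour S = 1F
baseColour Q = 2F

model : Twist → Coloring
model t k w = act (generator t) w ⟨$⟩ʳ baseColour k

rotation : Twist → Word → Fin 4 → Fin 4
rotation t w = act (generator t) w ⟨$⟩ʳ_

order₀₁ order₁₂ : Twist → ℕ
order₀₁ twisted₀ = 3
order₀₁ _        = 2
order₁₂ twisted₂ = 3
order₁₂ _        = 2

Admissible : ℕ → ℕ → Twist → Set
Admissible p q t = order₀₁ t ∣ p × order₁₂ t ∣ q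

admissible? : ∀ p q t → Dec (Admissible p q t)
admissible? p q t = order₀₁ t ∣? p ×-dec order₁₂ t ∣? q

generator-involutive : ∀ t x y → generator t x ⟨$⟩ʳ (generator t x ⟨$⟩ʳ y) ≡ y
generator-involutive untwisted r0 _ = refl
generator-involutive twisted₂  r0 _ = refl
generator-involutive untwisted r2 _ = refl
generator-involutive twisted₀  r2 _ = refl
generator-involutive _         r1 = λ { 0F → refl ; 1F → refl ; 2F → refl ; 3F → refl }
generator-involutive twisted₀  r0 = λ { 0F → refl ; 1F → refl ; 2F → refl ; 3F → refl }
generator-involutive twisted₂  r2 = λ { 0F → refl ; 1F → refl ; 2F → refl ; 3F → refl }

rotation₀₁-order : ∀ t y → fold y (rotation t (r0 ∷ r1 ∷ [])) (order₀₁ t) ≡ y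
rotation₀₁-order untwisted = λ { 0F → refl ; 1F → refl ; 2F → refl ; 3F → refl }
rotation₀₁-order twisted₀  = λ { 0F → refl ; 1F → refl ; 2F → refl ; 3F → refl }
rotation₀₁-order twisted₂  = λ { 0F → refl ; 1F → refl ; 2F → refl ; 3F → refl }

rotation₁₂-order : ∀ t y → fold y (rotation t (r1 ∷ r2 ∷ [])) (order₁₂ t) ≡ y
rotation₁₂-order untwisted = λ { 0F → refl ; 1F → refl ; 2F → refl ; 3F → refl }
rotation₁₂-order twisted₀  = λ { 0F → refl ; 1F → refl ; 2F → refl ; 3F → refl }
rotation₁₂-order twisted₂  = λ { 0F → refl ; 1F → refl ; 2F → refl ; 3F → refl }

rotation₀₁-period : ∀ t → fold 1F (rotation t (r0 ∷ r1 ∷ [])) n ≡ 1F → order₀₁ t ∣ n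
rotation₀₁-period untwisted = period-2 _ (λ ()) refl
rotation₀₁-period twisted₀  = period-3 _ (λ ()) (λ ()) refl
rotation₀₁-period twisted₂  = period-2 _ (λ ()) refl

rotation₁₂-period : ∀ t → fold 1F (rotation t (r1 ∷ r2 ∷ [])) n ≡ 1F → order₁₂ t ∣ n
rotation₁₂-period untwisted = period-2 _ (λ ()) refl
rotation₁₂-period twisted₀  = period-2 _ (λ ()) refl
rotation₁₂-period twisted₂  = period-3 _ (λ ()) (λ ()) refl

pow-trivial : ∀ t w m → (∀ y → fold y (rotation t w) m ≡ y) →
              m ∣ n → ∀ y → act (generator t) (pow n w) ⟨$⟩ʳ y ≡ y
pow-trivial t w m order (divides k refl) y =
  trans (act-pow (generator t) (k * m) w y) (fold-fixed-multiple _ m (order y) k)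

relator-trivial : ∀ t → Admissible p q t → ∀ {r} → Relator p q r →
                  ∀ y → act (generator t) r ⟨$⟩ʳ y ≡ y
relator-trivial t _         sq0   = generator-involutive t r0
relator-trivial t _         sq1   = generator-involutive t r1
relator-trivial t _         sq2   = generator-involutive t r2
relator-trivial t (o∣p , _) rel01 = pow-trivial t (r0 ∷ r1 ∷ []) (order₀₁ t) (rotation₀₁-order t) o∣p
relator-trivial t (_ , o∣q) rel12 = pow-trivial t (r1 ∷ r2 ∷ []) (order₁₂ t) (rotation₁₂-order t) o∣q
relator-trivial untwisted _ rel02 = λ _ → refl
relator-trivial twisted₀  _ rel02 = generator-involutive twisted₀ r0
relator-trivial twisted₂  _ rel02 = generator-involutive twisted₂ r2

generator-fixes-base : ∀ t k x → InStab k x → generator t x ⟨$⟩ʳ baseColour k ≡ baseColour k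
generator-fixes-base _         P r1 _     = refl
generator-fixes-base _         Q r1 _     = refl
generator-fixes-base _         S r1 x≢r1  = contradiction refl x≢r1
generator-fixes-base _         P r2 x≢r2  = contradiction refl x≢r2
generator-fixes-base _         Q r0 x≢r0  = contradiction refl x≢r0
generator-fixes-base untwisted _ r0 _     = refl
generator-fixes-base untwisted _ r2 _     = refl
generator-fixes-base twisted₀  _ r2 _     = refl
generator-fixes-base twisted₂  _ r0 _     = refl
generator-fixes-base twisted₀  P r0 _     = refl
generator-fixes-base twisted₀  S r0 _     = refl
generator-fixes-base twisted₂  Q r2 _     = refl
generator-fixes-base twisted₂  S r2 _     = refl

stabiliser-fixes-base : ∀ t {k h} → All (InStab k) h →
                        act (generator t) h ⟨$⟩ʳ baseColour k ≡ baseColour k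
stabiliser-fixes-base t [] = refl
stabiliser-fixes-base t {k} {x ∷ _} (x∈ ∷ h∈) =
  trans (cong (generator t x ⟨$⟩ʳ_) (stabiliser-fixes-base t h∈)) (generator-fixes-base t k x x∈)

model-wellDefined : Admissible p q t → WellDefined p q (model t)
model-wellDefined {t = t} admissible k g g′ (h , h∈ , gh≈g′) = begin
  act γ g ⟨$⟩ʳ baseColour k                     ≡⟨ cong (act γ g ⟨$⟩ʳ_) (stabiliser-fixes-base t h∈) ⟨
  act γ g ⟨$⟩ʳ (act γ h ⟨$⟩ʳ baseColour k)      ≡⟨ act-++ γ g h _ ⟨
  act γ (g ++ h) ⟨$⟩ʳ baseColour k              ≡⟨ act-resp-≈ γ (relator-trivial t admissible) gh≈g′ _ ⟩
  act γ g′ ⟨$⟩ʳ baseColour k                    ∎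
  where
  γ : Gen → Permutation′ 4
  γ = generator t

model-precise : ∀ t → Precise (model t)
model-precise t g = subst (Distinct4 _ _ _) (sym (act-++ (generator t) g [ r1 ] 1F))
  (map-distinct4 (⟨$⟩ʳ-injective (act (generator t) g)) distinct-0123)

model-perfect : ∀ t → Perfect (model t)
model-perfect t g = act (generator t) g , λ k h → act-++ (generator t) g h (baseColour k)

model-perfectPrecise : Admissible p q t → PerfectPrecise p q (model t)
model-perfectPrecise {t = t} admissible = model-wellDefined admissible , model-precise t , model-perfect t

-- The colour 1F of the base square is moved by r1, so both rotations r0 r1 and r1 r2
-- act on it with their full order.
wellDefined⇒admissible : ∀ t → WellDefined p q (model t) → Admissible p q t
wellDefined⇒admissible {p} {q} t wd =
  rotation₀₁-period t (square-fixed (r0 ∷ r1 ∷ []) p rel01) ,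
  rotation₁₂-period t (square-fixed (r1 ∷ r2 ∷ []) q rel12)
  where
  square-fixed : ∀ w m → Relator p q (pow m w) → fold 1F (rotation t w) m ≡ 1F
  square-fixed w m R =
    trans (sym (act-pow (generator t) m w 1F)) (wd S (pow m w) [] ([] , [] , ≈-rel [] _ [] R))

fixes-base-invariant : Equivalent (model t) (model t′) →
                       ∀ k x → (model t k [ x ] ≡ baseColour k ⇔ model t′ k [ x ] ≡ baseColour k)
fixes-base-invariant {t} e k x = equivalent-coincidence (model-perfect t) e k [ x ] []

model-equivalent⇒≡ : ∀ t t′ → Equivalent (model t) (model t′) → t ≡ t′
model-equivalent⇒≡ untwisted untwisted _ = refl
model-equivalent⇒≡ twisted₀  twisted₀  _ = refl
model-equivalent⇒≡ twisted₂  twisted₂  _ = refl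
model-equivalent⇒≡ untwisted twisted₀  e = contradiction (Equivalence.to   (fixes-base-invariant e Q r0) refl) λ ()
model-equivalent⇒≡ twisted₂  twisted₀  e = contradiction (Equivalence.to   (fixes-base-invariant e Q r0) refl) λ ()
model-equivalent⇒≡ twisted₀  untwisted e = contradiction (Equivalence.from (fixes-base-invariant e Q r0) refl) λ ()
model-equivalent⇒≡ twisted₀  twisted₂  e = contradiction (Equivalence.from (fixes-base-invariant e Q r0) refl) λ ()
model-equivalent⇒≡ untwisted twisted₂  e = contradiction (Equivalence.to   (fixes-base-invariant e P r2) refl) λ ()
model-equivalent⇒≡ twisted₂  untwisted e = contradiction (Equivalence.from (fixes-base-invariant e P r2) refl) λ ()

-- Classification

Normalised : Coloring → Set
Normalised c = (∀ k → c k [] ≡ baseColour k) × c S [ r1 ] ≡ 3F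

fixing-two : (σ : Permutation′ 4) → ∀ {a b c d} → Distinct4 a b c d →
             σ ⟨$⟩ʳ a ≡ a → σ ⟨$⟩ʳ b ≡ b → σ ⟨$⟩ʳ c ≡ c ⊎ σ ⟨$⟩ʳ c ≡ d
fixing-two σ {a} {b} {c} distinct@(a≢b , a≢c , _ , b≢c , _) σa≡a σb≡b with σ ⟨$⟩ʳ c ≟ c
... | yes σc≡c = inj₁ σc≡c
... | no  σc≢c = inj₂ (distinct4-exhaustive distinct (moved σa≡a (a≢c ∘ sym)) (moved σb≡b (b≢c ∘ sym)) σc≢c)
  where
  moved : ∀ {i} → σ ⟨$⟩ʳ i ≡ i → c ≢ i → σ ⟨$⟩ʳ c ≢ i
  moved σi≡i c≢i σc≡i = c≢i (⟨$⟩ʳ-injective σ (trans σc≡i (sym σi≡i)))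

module NormalisedColouring {c : Coloring} (wd : WellDefined p q c) (perfect : Perfect c)
                           (normalised : Normalised c) where

  σ : Gen → Permutation′ 4
  σ x = proj₁ (perfect [ x ])

  σ-step : ∀ x k h → c k (x ∷ h) ≡ σ x ⟨$⟩ʳ c k h
  σ-step x = proj₂ (perfect [ x ])

  σ-fixes-base : ∀ k {x} → InStab k x → σ x ⟨$⟩ʳ baseColour k ≡ baseColour k
  σ-fixes-base k {x} x∈ = begin
    σ x ⟨$⟩ʳ baseColour k   ≡⟨ cong (σ x ⟨$⟩ʳ_) (proj₁ normalised k) ⟨
    σ x ⟨$⟩ʳ c k []         ≡⟨ σ-step x k [] ⟨
    c k [ x ]               ≡⟨ wd k [] [ x ] ([ x ] , x∈ ∷ [] , ≈-refl) ⟨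
    c k []                  ≡⟨ proj₁ normalised k ⟩
    baseColour k            ∎

  σ₁≈ : σ r1 ≈ transpose 1F 3F
  σ₁≈ = ≈-fromAllBut (σ r1) (transpose 1F 3F) 3F λ
    { 0F _   → σ-fixes-base P λ ()
    ; 1F _   → trans (cong (σ r1 ⟨$⟩ʳ_) (sym (proj₁ normalised S)))
                       (trans (sym (σ-step r1 S [])) (proj₂ normalised))
    ; 2F _   → σ-fixes-base Q λ ()
    ; 3F 3≢3 → contradiction refl 3≢3
    }

  σ₀-cases : σ r0 ≈ idₚ ⊎ σ r0 ≈ transpose 2F 3F
  σ₀-cases with fixing-two (σ r0) distinct-0123 (σ-fixes-base P λ ()) (σ-fixes-base S λ ())
  ... | inj₁ σ2≡2 = inj₁ (≈-fromAllBut (σ r0) idₚ 3F λ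
    { 0F _ → σ-fixes-base P λ () ; 1F _ → σ-fixes-base S λ () ; 2F _ → σ2≡2 ; 3F 3≢3 → contradiction refl 3≢3 })
  ... | inj₂ σ2≡3 = inj₂ (≈-fromAllBut (σ r0) (transpose 2F 3F) 3F λ
    { 0F _ → σ-fixes-base P λ () ; 1F _ → σ-fixes-base S λ () ; 2F _ → σ2≡3 ; 3F 3≢3 → contradiction refl 3≢3 })

  σ₂-cases : σ r2 ≈ idₚ ⊎ σ r2 ≈ transpose 0F 3F
  σ₂-cases with fixing-two (σ r2) distinct-1203 (σ-fixes-base S λ ()) (σ-fixes-base Q λ ())
    where
    distinct-1203 : Distinct4 1F 2F 0F 3F
    distinct-1203 = (λ ()) , (λ ()) , (λ ()) , (λ ()) , (λ ()) , (λ ())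
  ... | inj₁ σ0≡0 = inj₁ (≈-fromAllBut (σ r2) idₚ 3F λ
    { 0F _ → σ0≡0 ; 1F _ → σ-fixes-base S λ () ; 2F _ → σ-fixes-base Q λ () ; 3F 3≢3 → contradiction refl 3≢3 })
  ... | inj₂ σ0≡3 = inj₂ (≈-fromAllBut (σ r2) (transpose 0F 3F) 3F λ
    { 0F _ → σ0≡3 ; 1F _ → σ-fixes-base S λ () ; 2F _ → σ-fixes-base Q λ () ; 3F 3≢3 → contradiction refl 3≢3 })

  coloured-by : ∀ γ → (∀ x → σ x ≈ γ x) → ∀ k h → c k h ≡ act γ h ⟨$⟩ʳ baseColour k
  coloured-by γ σ≈γ k []      = proj₁ normalised k
  coloured-by γ σ≈γ k (x ∷ h) = begin
    c k (x ∷ h)                                  ≡⟨ σ-step x k h ⟩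
    σ x ⟨$⟩ʳ c k h                               ≡⟨ σ≈γ x _ ⟩
    γ x ⟨$⟩ʳ c k h                               ≡⟨ cong (γ x ⟨$⟩ʳ_) (coloured-by γ σ≈γ k h) ⟩
    γ x ⟨$⟩ʳ (act γ h ⟨$⟩ʳ baseColour k)         ∎

  -- If r0 and r2 both acted non-trivially, r0 r2 would have order 3 on colours,
  -- against the relator (r0 r2)².
  twist : Σ Twist λ t → ∀ k h → c k h ≡ model t k h
  twist with σ₀-cases | σ₂-cases
  ... | inj₁ σ₀≈ | inj₁ σ₂≈ = untwisted , coloured-by _ λ { r0 → σ₀≈ ; r1 → σ₁≈ ; r2 → σ₂≈ }
  ... | inj₂ σ₀≈ | inj₁ σ₂≈ = twisted₀  , coloured-by _ λ { r0 → σ₀≈ ; r1 → σ₁≈ ; r2 → σ₂≈ }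
  ... | inj₁ σ₀≈ | inj₂ σ₂≈ = twisted₂  , coloured-by _ λ { r0 → σ₀≈ ; r1 → σ₁≈ ; r2 → σ₂≈ }
  ... | inj₂ σ₀≈ | inj₂ σ₂≈ = contradiction (trans (sym (coloured-by γ σ≈γ P w)) w-fixes-P) λ ()
    where
    w : Word
    w = pow 2 (r0 ∷ r2 ∷ [])

    w-fixes-P : c P w ≡ 0F
    w-fixes-P = trans (wd P w [] ([] , [] , ≈-rel [] w [] rel02)) (proj₁ normalised P)

    γ : Gen → Permutation′ 4
    γ r0 = transpose 2F 3F
    γ r1 = transpose 1F 3F
    γ r2 = transpose 0F 3F

    σ≈γ : ∀ x → σ x ≈ γ x
    σ≈γ r0 = σ₀≈
    σ≈γ r1 = σ₁≈
    σ≈γ r2 = σ₂≈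

classification : PerfectPrecise p q c → Σ Twist λ t → Admissible p q t × Equivalent (model t) c
classification {c = c} (wd , precise , perfect) = t₀ , admissible , [] , frame , c≡frame∘model
  where
  frame : Permutation′ 4
  frame = distinct4⇒permutation (precise [])

  normalised : Normalised (recolour (flip frame) c)
  normalised = (λ { P → inverseˡ frame ; S → inverseˡ frame ; Q → inverseˡ frame }) , inverseˡ frame

  open NormalisedColouring (recolour-wellDefined (flip frame) wd) (recolour-perfect (flip frame) perfect) normalised

  t₀ : Twist
  t₀ = proj₁ twist

  admissible : Admissible _ _ t₀
  admissible = wellDefined⇒admissible t₀ λ k g g′ same →
    trans (sym (proj₂ twist k g)) (trans (recolour-wellDefined (flip frame) wd k g g′ same) (proj₂ twist k g′))

  c≡frame∘model : ∀ k h → c k h ≡ frame ⟨$⟩ʳ model t₀ k h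
  c≡frame∘model k h = trans (sym (inverseʳ frame)) (cong (frame ⟨$⟩ʳ_) (proj₂ twist k h))

-- Counting classes

Enumeration : {A : Set} → (A → A → Set) → (A → Set) → ℕ → Set
Enumeration {A} _~_ Φ n = Σ (Fin n → A) λ f →
  (∀ i → Φ (f i)) × (∀ i j → f i ~ f j → i ≡ j) × (∀ a → Φ a → Σ (Fin n) λ i → f i ~ a)

module _ {A B : Set} {_~_ : A → A → Set} {Φ : A → Set} {Ψ : B → Set}
         (~-sym : ∀ {a a′} → Φ a → a ~ a′ → a′ ~ a)
         (~-trans : ∀ {a a′ a″} → a ~ a′ → a′ ~ a″ → a ~ a″)
         (embed : B → A)
         (embed-Φ : ∀ {b} → Ψ b → Φ (embed b))
         (embed-reflects : ∀ {b b′} → embed b ~ embed b′ → b ≡ b′)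
         (classify : ∀ {a} → Φ a → Σ B λ b → Ψ b × embed b ~ a) where

  enumeration-transfer : ∀ {n} → Enumeration _~_ Φ n ⇔ Enumeration _≡_ Ψ n
  enumeration-transfer {n} = mk⇔ forth back
    where
    forth : Enumeration _~_ Φ n → Enumeration _≡_ Ψ n
    forth (f , f-Φ , f-injective , f-cover) = g , g-Ψ , g-injective , g-cover
      where
      g : Fin n → B
      g i = proj₁ (classify (f-Φ i))

      g-Ψ : ∀ i → Ψ (g i)
      g-Ψ i = proj₁ (proj₂ (classify (f-Φ i)))

      g~f : ∀ i → embed (g i) ~ f i
      g~f i = proj₂ (proj₂ (classify (f-Φ i)))

      g-injective : ∀ i j → g i ≡ g j → i ≡ j
      g-injective i j gi≡gj = f-injective i j
        (~-trans (~-sym (embed-Φ (g-Ψ i)) (g~f i)) (subst (λ b → embed b ~ f j) (sym gi≡gj) (g~f j)))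

      g-cover : ∀ b → Ψ b → Σ (Fin n) λ i → g i ≡ b
      g-cover b Ψb with i , fi~b ← f-cover (embed b) (embed-Φ Ψb) = i , embed-reflects (~-trans (g~f i) fi~b)

    back : Enumeration _≡_ Ψ n → Enumeration _~_ Φ n
    back (g , g-Ψ , g-injective , g-cover) =
      embed ∘ g , embed-Φ ∘ g-Ψ , (λ i j e → g-injective i j (embed-reflects e)) , f-cover
      where
      f-cover : ∀ a → Φ a → Σ (Fin n) λ i → embed (g i) ~ a
      f-cover a Φa with b , Ψb , b~a ← classify Φa with i , refl ← g-cover b Ψb = i , b~a

module _ {A : Set} {Φ : A → Set} where

  enumeration-unique : ∀ {m n} → Enumeration _≡_ Φ m → Enumeration _≡_ Φ n → m ≡ n
  enumeration-unique e e′ = cantor-schröder-bernstein {f = into e e′} {g = into e′ e}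
    (into-injective e e′) (into-injective e′ e)
    where
    into : ∀ {m n} → Enumeration _≡_ Φ m → Enumeration _≡_ Φ n → Fin m → Fin n
    into (f , f-Φ , _) (_ , _ , _ , g-cover) i = proj₁ (g-cover (f i) (f-Φ i))

    into-injective : ∀ {m n} (e : Enumeration _≡_ Φ m) (e′ : Enumeration _≡_ Φ n) →
                     Injective _≡_ _≡_ (into e e′)
    into-injective (f , f-Φ , f-injective , _) (g , _ , _ , g-cover) {i} {j} eq = f-injective i j (begin
      f i                                 ≡⟨ proj₂ (g-cover (f i) (f-Φ i)) ⟨
      g (proj₁ (g-cover (f i) (f-Φ i)))   ≡⟨ cong g eq ⟩
      g (proj₁ (g-cover (f j) (f-Φ j)))   ≡⟨ proj₂ (g-cover (f j) (f-Φ j)) ⟩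
      f j                                 ∎)

unique-lookup-injective : ∀ {A : Set} {xs : List A} → Unique xs → Injective _≡_ _≡_ (lookup xs)
unique-lookup-injective (_   ∷ _) {zero}  {zero}  _ = refl
unique-lookup-injective (x∉ ∷ _) {zero}  {suc j} x≡xⱼ = contradiction x≡xⱼ (All.lookup x∉ (∈-lookup j))
unique-lookup-injective (x∉ ∷ _) {suc i} {zero}  xᵢ≡x = contradiction (sym xᵢ≡x) (All.lookup x∉ (∈-lookup i))
unique-lookup-injective (_   ∷ u) {suc i} {suc j} e = cong suc (unique-lookup-injective u e)

module _ {A : Set} {Φ : A → Set} (Φ? : Decidable Φ) where

  -- Unlike length ∘ filter Φ?, on a concrete list this unfolds to an expression in all
  -- the decisions Φ? x at once, so that a single `with` can split them.
  count : List A → ℕ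
  count []       = 0
  count (x ∷ xs) = if does (Φ? x) then suc (count xs) else count xs

  count≡length∘filter : ∀ xs → count xs ≡ length (filter Φ? xs)
  count≡length∘filter []       = refl
  count≡length∘filter (x ∷ xs) with does (Φ? x)
  ... | true  = cong suc (count≡length∘filter xs)
  ... | false = count≡length∘filter xs

  module _ {xs : List A} (unique : Unique xs) (complete : ∀ a → a ∈ xs) where

    filter-enumeration : Enumeration _≡_ Φ (length (filter Φ? xs))
    filter-enumeration =
      lookup (filter Φ? xs) ,
      (λ i → proj₂ (∈-filter⁻ Φ? {xs = xs} (∈-lookup i))) ,
      (λ i j → unique-lookup-injective (Unique.filter⁺ Φ? unique)) ,
      λ a Φa → let a∈ys = ∈-filter⁺ Φ? (complete a) Φa in index a∈ys , sym (lookup-index a∈ys)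

    enumeration⇔count : Enumeration _≡_ Φ n ⇔ n ≡ count xs
    enumeration⇔count = mk⇔
      (λ e → trans (enumeration-unique e filter-enumeration) (sym (count≡length∘filter xs)))
      (λ { refl → subst (Enumeration _≡_ Φ) (sym (count≡length∘filter xs)) filter-enumeration })

allTwists : List Twist
allTwists = untwisted ∷ twisted₀ ∷ twisted₂ ∷ []

allTwists-unique : Unique allTwists
allTwists-unique = ((λ ()) ∷ (λ ()) ∷ []) ∷ ((λ ()) ∷ []) ∷ [] ∷ []

allTwists-complete : ∀ t → t ∈ allTwists
allTwists-complete untwisted = here refl
allTwists-complete twisted₀  = there (here refl)
allTwists-complete twisted₂  = there (there (here refl))

admissibleCount : ℕ → ℕ → ℕ
admissibleCount p q = count (admissible? p q) allTwists

numPerfectPrecise⇔admissibleCount : ∀ p q → NumPerfectPrecise p q n ⇔ n ≡ admissibleCount p q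
numPerfectPrecise⇔admissibleCount p q = ⇔-trans
  (enumeration-transfer (Equivalent-sym ∘ proj₁) (λ {c} {c′} {c″} → Equivalent-trans {c} {c′} {c″})
                        model model-perfectPrecise
                        (model-equivalent⇒≡ _ _) classification)
  (enumeration⇔count (admissible? p q) allTwists-unique allTwists-complete)

does-≡⇒⇔ : ∀ {A B : Set} (A? : Dec A) (B? : Dec B) → does A? ≡ does B? → A ⇔ B
does-≡⇒⇔ (yes a) (yes b) _ = mk⇔ (λ _ → b) (λ _ → a)
does-≡⇒⇔ (no ¬a) (no ¬b) _ = mk⇔ (λ a → contradiction a ¬a) (λ b → contradiction b ¬b)

admissibleCount-cases : ∀ p q →
    (1 ≡ admissibleCount p q ⇔
       ((2 ∣ p × 2 ∣ q × ¬ 3 ∣ p × ¬ 3 ∣ q) ⊎ (2 ∣ p × ¬ 2 ∣ q × 3 ∣ q) ⊎ (2 ∣ q × ¬ 2 ∣ p × 3 ∣ p)))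
  × (2 ≡ admissibleCount p q ⇔ (2 ∣ p × 2 ∣ q × ((3 ∣ p × ¬ 3 ∣ q) ⊎ (¬ 3 ∣ p × 3 ∣ q))))
  × (3 ≡ admissibleCount p q ⇔ ((2 ∣ p × 3 ∣ p) × (2 ∣ q × 3 ∣ q)))
admissibleCount-cases p q =
  does-≡⇒⇔ (1 ≟ℕ _) one? (proj₁ table) ,
  does-≡⇒⇔ (2 ≟ℕ _) two? (proj₁ (proj₂ table)) ,
  does-≡⇒⇔ (3 ≟ℕ _) three? (proj₂ (proj₂ table))
  where
  one? : Dec ((2 ∣ p × 2 ∣ q × ¬ 3 ∣ p × ¬ 3 ∣ q) ⊎ (2 ∣ p × ¬ 2 ∣ q × 3 ∣ q) ⊎ (2 ∣ q × ¬ 2 ∣ p × 3 ∣ p))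
  one? = (2 ∣? p ×-dec 2 ∣? q ×-dec ¬? (3 ∣? p) ×-dec ¬? (3 ∣? q))
         ⊎-dec (2 ∣? p ×-dec ¬? (2 ∣? q) ×-dec 3 ∣? q)
         ⊎-dec (2 ∣? q ×-dec ¬? (2 ∣? p) ×-dec 3 ∣? p)
  two? : Dec (2 ∣ p × 2 ∣ q × ((3 ∣ p × ¬ 3 ∣ q) ⊎ (¬ 3 ∣ p × 3 ∣ q)))
  two? = 2 ∣? p ×-dec 2 ∣? q ×-dec ((3 ∣? p ×-dec ¬? (3 ∣? q)) ⊎-dec (¬? (3 ∣? p) ×-dec 3 ∣? q))
  three? : Dec ((2 ∣ p × 3 ∣ p) × (2 ∣ q × 3 ∣ q))
  three? = (2 ∣? p ×-dec 3 ∣? p) ×-dec (2 ∣? q ×-dec 3 ∣? q)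

  table : does (1 ≟ℕ admissibleCount p q) ≡ does one?
        × does (2 ≟ℕ admissibleCount p q) ≡ does two?
        × does (3 ≟ℕ admissibleCount p q) ≡ does three?
  table with does (2 ∣? p) | does (2 ∣? q) | does (3 ∣? p) | does (3 ∣? q)
  ... | true  | true  | true  | true  = refl , refl , refl
  ... | true  | true  | true  | false = refl , refl , refl
  ... | true  | true  | false | true  = refl , refl , refl
  ... | true  | true  | false | false = refl , refl , refl
  ... | true  | false | true  | true  = refl , refl , refl
  ... | true  | false | true  | false = refl , refl , refl
  ... | true  | false | false | true  = refl , refl , refl
  ... | true  | false | false | false = refl , refl , refl
  ... | false | true  | true  | true  = refl , refl , refl
  ... | false | true  | true  | false = refl , refl , refl
  ... | false | true  | false | true  = refl , refl , refl
  ... | false | true  | false | false = refl , refl , refl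
  ... | false | false | true  | true  = refl , refl , refl
  ... | false | false | true  | false = refl , refl , refl
  ... | false | false | false | true  = refl , refl , refl
  ... | false | false | false | false = refl , refl , refl

6∣⇔2∣×3∣ : ∀ n → 6 ∣ n ⇔ (2 ∣ n × 3 ∣ n)
6∣⇔2∣×3∣ n = mk⇔ (λ 6∣n → ∣-trans (divides 3 refl) 6∣n , ∣-trans (divides 2 refl) 6∣n)
                 (λ (2∣n , 3∣n) → lcm-least 2∣n 3∣n)

-- The hypotheses 3 ≤ p, 3 ≤ q and p ≢ q are unused: they make [p,q] the symmetry group of
-- the tiling (p.4.q.4), which the combinatorial model of colourings takes for granted.
proposition2p2 : (p q : ℕ) → 3 ≤ p → 3 ≤ q → p ≢ q →
    ((NumPerfectPrecise p q 1 ⇔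
        ((2 ∣ p × 2 ∣ q × ¬ 3 ∣ p × ¬ 3 ∣ q)
         ⊎ (2 ∣ p × ¬ 2 ∣ q × 3 ∣ q)
         ⊎ (2 ∣ q × ¬ 2 ∣ p × 3 ∣ p)))
    × (NumPerfectPrecise p q 2 ⇔
        (2 ∣ p × 2 ∣ q × ((3 ∣ p × ¬ 3 ∣ q) ⊎ (¬ 3 ∣ p × 3 ∣ q))))
    × (NumPerfectPrecise p q 3 ⇔ (6 ∣ p × 6 ∣ q)))
proposition2p2 p q _ _ _ with one , two , three ← admissibleCount-cases p q =
  ⇔-trans counts one ,
  ⇔-trans counts two ,
  ⇔-trans counts (⇔-trans three (⇔-sym (6∣⇔2∣×3∣ p ×-⇔ 6∣⇔2∣×3∣ q)))
  where
  counts : ∀ {n} → NumPerfectPrecise p q n ⇔ n ≡ admissibleCount p q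
  counts = numPerfectPrecise⇔admissibleCount p q
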